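{- Let $u_1\cdots u_n$ be the place-based non-inversion table of a permutation $\pi\in S_n$ and let $i<j$. Then $u_i<u_k$ for all $i<k<j$ and $u_i\ge u_j$ hold if and only if $\pi(j)<\pi(i)<\pi(k)$ for all $i<k<j$.
   Context: The place-based non-inversion table of $\pi\in S_n$ is the word $u_1\cdots u_n$ with $u_j=1+|\{i<j:\pi(i)<\pi(j)\}|$. -}

module Defs where

open import Data.Nat using (ℕ; suc)
open import Data.Fin using (Fin; _<_; _<?_)
open import Data.Fin.Permutation using (Permutation′; _⟨$⟩ʳ_)
open import Data.List using (length; filter; allFin)
open import Relation.Nullary.Decidable using (_×-dec_)

-- Place-based non-inversion table entry:
-- u_j = 1 + |{ i < j : π(i) < π(j) }|   (positions are Fin n, 0-indexed)
nonInvTable : ∀ {n} → Permutation′ n → Fin n → ℕ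
nonInvTable {n} π j =
  suc (length (filter (λ i → (i <? j) ×-dec ((π ⟨$⟩ʳ i) <? (π ⟨$⟩ʳ j))) (allFin n)))

module Submission where

-- Write u = nonInvTable π, so u j = 1 + |N j| where N j = { l < j : π l < π j }
-- is the set of non-inversions ending at position j.  The whole corollary is
-- driven by two comparisons between entries of the table, both obtained by
-- comparing the sets N j as sets (hence their sizes):
--   * rising:   if i < k and π i < π k, then N i ⊊ N k (witnessed by i), so u i < u k;
--   * dropping: if i < k, π k < π i and π i < π l for every l strictly between,
--               then N k ⊆ N i, so u k ≤ u i.
-- Backward direction: the rising lemma gives u i < u k for i < k < j, and the
-- dropping lemma (with k = j) gives u j ≤ u i.
-- Forward direction: for i < k < j we show π i < π k by well-founded induction
-- on k — if π k < π i, the induction hypothesis makes the dropping lemma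
-- applicable, so u k ≤ u i, contradicting u i < u k.  Finally π j < π i, since
-- π i < π j would give u i < u j by the rising lemma.

open import Defs
open import Data.Nat using (_≥_) renaming (_<_ to _<ℕ_)
open import Data.Fin using (Fin; _<_)
open import Data.Fin.Permutation using (Permutation′; _⟨$⟩ʳ_)
open import Data.Product using (_×_; _,_)
open import Function.Bundles using (_⇔_; mk⇔; Injection)

open import Data.Nat using (ℕ; _≤_; s≤s; z≤n)
open import Data.Nat.Properties using (m≤n⇒m≤1+n; <⇒≱)
open import Data.Fin using (_<?_)
open import Data.Fin.Properties using (<-cmp; <-trans; <-irrefl)
open import Data.Fin.Induction using (<-wellFounded)
open import Data.Sum using (_⊎_; inj₁; inj₂)
open import Data.List using ([]; _∷_; length; filter; allFin)
open import Data.List.Properties using (filter-accept; filter-reject)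
open import Data.List.Membership.Propositional using (_∈_)
open import Data.List.Membership.Propositional.Properties using (∈-allFin)
open import Data.List.Relation.Unary.Any using (here; there)
open import Data.Empty using (⊥-elim)
open import Function.Properties.Inverse using (Inverse⇒Injection)
open import Induction.WellFounded using (Acc; acc)
open import Relation.Binary using (tri<; tri≈; tri>)
open import Relation.Binary.PropositionalEquality using (_≡_; refl)
open import Relation.Nullary using (¬_; yes; no)
open import Relation.Nullary.Decidable using (_×-dec_)
open import Relation.Unary using (Pred; Decidable)
open import Level using (0ℓ)

module FilterLength {A : Set} {P Q : Pred A 0ℓ}
                    (P? : Decidable P) (Q? : Decidable Q)
                    (P⇒Q : ∀ x → P x → Q x) where

  length-filter-mono : ∀ xs → length (filter P? xs) ≤ length (filter Q? xs)
  length-filter-mono [] = z≤n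
  length-filter-mono (x ∷ xs) with P? x | Q? x
  ... | yes _  | yes _  = s≤s (length-filter-mono xs)
  ... | yes px | no ¬qx = ⊥-elim (¬qx (P⇒Q x px))
  ... | no _   | yes _  = m≤n⇒m≤1+n (length-filter-mono xs)
  ... | no _   | no _   = length-filter-mono xs

  length-filter-strict : ∀ {y} xs → y ∈ xs → Q y → ¬ P y →
                         length (filter P? xs) <ℕ length (filter Q? xs)
  length-filter-strict (y ∷ xs) (here refl) qy ¬py
    rewrite filter-reject P? {xs = xs} ¬py | filter-accept Q? {xs = xs} qy =
      s≤s (length-filter-mono xs)
  length-filter-strict (x ∷ xs) (there y∈xs) qy ¬py with P? x | Q? x
  ... | yes _  | yes _  = s≤s (length-filter-strict xs y∈xs qy ¬py)
  ... | yes px | no ¬qx = ⊥-elim (¬qx (P⇒Q x px))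
  ... | no _   | yes _  = m≤n⇒m≤1+n (length-filter-strict xs y∈xs qy ¬py)
  ... | no _   | no _   = length-filter-strict xs y∈xs qy ¬py

module NonInversionTable {n} (π : Permutation′ n) where

  σ : Fin n → Fin n
  σ x = π ⟨$⟩ʳ x

  u : Fin n → ℕ
  u = nonInvTable π

  σ-injective : ∀ {a b} → σ a ≡ σ b → a ≡ b
  σ-injective = Injection.injective (Inverse⇒Injection π)

  σ-compare : ∀ {a b} → a < b → σ a < σ b ⊎ σ b < σ a
  σ-compare {a} {b} a<b with <-cmp (σ a) (σ b)
  ... | tri< σa<σb _ _ = inj₁ σa<σb
  ... | tri≈ _ σa≡σb _ = ⊥-elim (<-irrefl (σ-injective σa≡σb) a<b)
  ... | tri> _ _ σb<σa = inj₂ σb<σa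

  N : Fin n → Pred (Fin n) 0ℓ
  N j l = l < j × σ l < σ j

  u-mono : ∀ {j k} → (∀ l → N j l → N k l) → u j ≤ u k
  u-mono {j} {k} N⊆ = s≤s (length-filter-mono (allFin n))
    where open FilterLength (λ l → (l <? j) ×-dec (σ l <? σ j))
                            (λ l → (l <? k) ×-dec (σ l <? σ k)) N⊆

  u-strict : ∀ {j k} → (∀ l → N j l → N k l) → ∀ y → N k y → ¬ N j y → u j <ℕ u k
  u-strict {j} {k} N⊆ y Nky ¬Njy =
      s≤s (length-filter-strict (allFin n) (∈-allFin y) Nky ¬Njy)
    where open FilterLength (λ l → (l <? j) ×-dec (σ l <? σ j))
                            (λ l → (l <? k) ×-dec (σ l <? σ k)) N⊆

  -- Rising lemma: a non-inversion i < k strictly increases the table entry,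
  -- since N i ⊆ N k and i ∈ N k ∖ N i.
  rising : ∀ {i k} → i < k → σ i < σ k → u i <ℕ u k
  rising i<k σi<σk =
    u-strict (λ l (l<i , σl<σi) → <-trans l<i i<k , <-trans σl<σi σi<σk)
             _ (i<k , σi<σk) (λ (i<i , _) → <-irrefl refl i<i)

  -- Dropping lemma: if σ k < σ i for i < k and every position strictly
  -- between lies above σ i, then N k ⊆ N i, so the entry does not increase.
  dropping : ∀ {i k} → i < k → σ k < σ i →
             (∀ l → i < l → l < k → σ i < σ l) → u k ≤ u i
  dropping {i} {k} i<k σk<σi above = u-mono N⊆
    where
    N⊆ : ∀ l → N k l → N i l
    N⊆ l (l<k , σl<σk) with <-cmp l i
    ... | tri< l<i _ _  = l<i , <-trans σl<σk σk<σi
    ... | tri≈ _ refl _ = ⊥-elim (<-irrefl refl (<-trans σl<σk σk<σi))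
    ... | tri> _ _ i<l  =
      ⊥-elim (<-irrefl refl (<-trans (<-trans (above l i<l l<k) σl<σk) σk<σi))

  -- If u i < u k for every i < k < j, then σ i < σ k for every such k.  By
  -- induction on k: a first k with σ k < σ i would satisfy u k ≤ u i.
  above-between : ∀ {i j} → (∀ k → i < k → k < j → u i <ℕ u k) →
                  ∀ k → Acc _<_ k → i < k → k < j → σ i < σ k
  above-between {i} H k (acc rec) i<k k<j with σ-compare i<k
  ... | inj₁ σi<σk = σi<σk
  ... | inj₂ σk<σi = ⊥-elim (<⇒≱ (H k i<k k<j) (dropping i<k σk<σi above-i))
    where
    above-i : ∀ l → i < l → l < k → σ i < σ l
    above-i l i<l l<k = above-between H l (rec l<k) i<l (<-trans l<k k<j)

corollary6p5 : ∀ {n} (π : Permutation′ n) (i j : Fin n) → i < j →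
    (((∀ (k : Fin n) → i < k → k < j → nonInvTable π i <ℕ nonInvTable π k)
        × nonInvTable π i ≥ nonInvTable π j)
     ⇔ ((π ⟨$⟩ʳ j) < (π ⟨$⟩ʳ i)
        × (∀ (k : Fin n) → i < k → k < j → (π ⟨$⟩ʳ i) < (π ⟨$⟩ʳ k))))
corollary6p5 π i j i<j = mk⇔ forward backward
  where
  open NonInversionTable π

  RisesThenDrops : Set
  RisesThenDrops = (∀ k → i < k → k < j → u i <ℕ u k) × u i ≥ u j

  DropsThenAbove : Set
  DropsThenAbove = σ j < σ i × (∀ k → i < k → k < j → σ i < σ k)

  forward : RisesThenDrops → DropsThenAbove
  forward (u-rises , u-drops) = σj<σi , σi<σk
    where
    σi<σk : ∀ k → i < k → k < j → σ i < σ k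
    σi<σk k = above-between u-rises k (<-wellFounded k)

    σj<σi : σ j < σ i
    σj<σi with σ-compare i<j
    ... | inj₁ σi<σj = ⊥-elim (<⇒≱ (rising i<j σi<σj) u-drops)
    ... | inj₂ σj<σi = σj<σi

  backward : DropsThenAbove → RisesThenDrops
  backward (σj<σi , σi<σk) =
    (λ k i<k k<j → rising i<k (σi<σk k i<k k<j)) , dropping i<j σj<σi σi<σk
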